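{- For all integers $n\ge 0$ and $r\ge 1$, \[\sum_{k=0}^{\infty}\overline{p}(n-rT_k)=\sigma_r\overline{\mathrm{mex}}(n),\] where $T_k=\frac{k(k+1)}{2}$ and $\overline{p}(m)=0$ for $m<0$.
   Context: An overpartition of $n$ is a non-increasing sequence of positive integers summing to $n$ in which the first occurrence of each distinct part may be overlined (the empty overpartition is the unique overpartition of $0$). $\overline{p}(n)$ is the number of overpartitions of $n$. For a positive integer $r$ and an overpartition $\pi$, the least $r$-gap $\overline{\mathrm{mex}}_r(\pi)$ is the smallest positive integer that appears fewer than $r$ times among the non-overlined parts of $\pi$. Then $\sigma_r\overline{\mathrm{mex}}(n)=\sum_{\pi}\overline{\mathrm{mex}}_r(\pi)$, summed over all overpartitions $\pi$ of $n$. -}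

module Defs where

open import Data.Nat using (ℕ; zero; suc; _+_; _*_; _∸_; _≤_; _<_; _≟_; _<?_; _≤?_)
open import Data.Bool using (Bool; true; false; if_then_else_)
open import Data.Product using (_×_; _,_; proj₁)
open import Data.List using (List; []; _∷_; length; map; filter; upTo)
open import Data.Nat.ListAction using (sum)
open import Data.Unit using (⊤)
open import Data.List.Membership.Propositional using (_∈_)
open import Data.List.Relation.Unary.Unique.Propositional using (Unique)
open import Relation.Nullary using (¬_; does)
open import Relation.Binary.PropositionalEquality using (_≡_; _≢_)

-- An overpartition is represented as a list of (part , overlined?) pairs,
-- listed in non-increasing order of parts; within a run of equal parts the
-- (optional) overlined copy is the first entry of the run.
Part : Set
Part = ℕ × Bool

AllPositive : List Part → Set
AllPositive [] = ⊤
AllPositive ((a , _) ∷ π) = (1 ≤ a) × AllPositive π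

NonIncreasing : List Part → Set
NonIncreasing [] = ⊤
NonIncreasing (_ ∷ []) = ⊤
NonIncreasing ((a , _) ∷ (b , y) ∷ π) = (b ≤ a) × NonIncreasing ((b , y) ∷ π)

FirstOverlined : List Part → Set
FirstOverlined [] = ⊤
FirstOverlined (_ ∷ []) = ⊤
FirstOverlined ((a , _) ∷ (b , y) ∷ π) =
  (a ≡ b → y ≡ false) × FirstOverlined ((b , y) ∷ π)

partSum : List Part → ℕ
partSum π = sum (map proj₁ π)

IsOverpartition : ℕ → List Part → Set
IsOverpartition n π =
  AllPositive π × NonIncreasing π × FirstOverlined π × (partSum π ≡ n)

countNonOver : List Part → ℕ → ℕ
countNonOver [] m = 0
countNonOver ((a , true) ∷ π) m = countNonOver π m
countNonOver ((a , false) ∷ π) m =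
  if does (a ≟ m) then suc (countNonOver π m) else countNonOver π m

mexSearch : ℕ → List Part → ℕ → ℕ → ℕ
mexSearch r π k zero = k
mexSearch r π k (suc fuel) =
  if does (countNonOver π k <? r) then k else mexSearch r π (suc k) fuel

-- The search over 1 .. length π + 1 always succeeds
-- for r ≥ 1 since some value in that range does not occur at all.
mexBar : ℕ → List Part → ℕ
mexBar r π = mexSearch r π 1 (suc (length π))

record Enumerates (n : ℕ) (L : List (List Part)) : Set where
  field
    complete : ∀ π → IsOverpartition n π → π ∈ L
    sound    : ∀ π → π ∈ L → IsOverpartition n π
    unique   : Unique L

T : ℕ → ℕ
T zero = 0
T (suc k) = T k + suc k

term : (ℕ → List (List Part)) → ℕ → ℕ → ℕ → ℕ
term enum n r k =
  if does (r * T k ≤? n) then length (enum (n ∸ r * T k)) else 0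

{-# OPTIONS --safe #-}
module Submission where

open import Defs
open import Data.Nat using (ℕ; zero; suc; _+_; _*_; _∸_; _≤_; _<_; z≤n; s≤s; s≤s⁻¹; _≟_; _≤?_; _<?_; _≤′_; ≤′-refl; ≤′-step)
open import Data.Nat.Properties
open import Data.Nat.ListAction using (sum)
open import Data.Bool using (true; false; if_then_else_)
open import Data.List using (List; []; _∷_; [_]; length; map; filter; upTo; applyUpTo)
open import Data.List.Properties using (map-cong; map-cong-local; map-upTo; filter-none; filter-all; filter-≐; length-map)
open import Data.List.Membership.Propositional using (_∈_)
open import Data.List.Membership.Propositional.Properties using (∈-filter⁺; ∈-filter⁻; ∈-map⁺; ∈-map⁻)
open import Data.List.Membership.Propositional.Properties.WithK using (unique∧set⇒bag)
open import Data.List.Relation.Binary.BagAndSetEquality using (_∼[_]_; set; ∼bag⇒↭)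
open import Data.List.Relation.Binary.Permutation.Propositional.Properties using (↭-length)
open import Data.List.Relation.Unary.All as All using (All)
open import Data.List.Relation.Unary.Linked as Linked using (Linked; []; [-]; _∷_)
open import Data.List.Relation.Unary.Unique.Propositional using (Unique)
import Data.List.Relation.Unary.Unique.Propositional.Properties as Unique
open import Data.Product using (_×_; _,_; proj₁; proj₂; ∃-syntax)
open import Data.Sum using (_⊎_; inj₁; inj₂)
open import Data.Unit using (⊤; tt)
open import Function using (_∘_; id)
open import Function.Bundles using (_⇔_; mk⇔; Equivalence)
open import Relation.Binary.PropositionalEquality using (_≡_; _≢_; refl; sym; trans; cong; subst; module ≡-Reasoning)
open import Relation.Nullary using (Dec; does; yes; no; ¬_; contradiction)
open import Relation.Nullary.Decidable using (_×-dec_; dec-true; dec-false; dec-yes-irr; dec-no; does-⇔)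
open import Relation.Unary using (Decidable)
open import Algebra.Properties.CommutativeSemigroup +-commutativeSemigroup using (interchange; x∙yz≈y∙xz)

-- Write Covers r k π for "each of 1, …, k occurs at least r times among the non-overlined parts
-- of π", i.e. k < mex̄_r(π). Then mex̄_r(π) = #{k ≥ 0 : Covers r k π}, so the right-hand side
-- counts the pairs (k, π) with Covers r k π. For fixed k, deleting r non-overlined copies of each
-- of 1, …, k is a bijection from the overpartitions of n satisfying Covers r k onto those of
-- n − r T_k, which gives the k-th term on the left. The bijection is assembled one part at a time
-- from inserting a single non-overlined part m into its sorted position, which is invertible on
-- overpartitions containing a non-overlined m and changes no other multiplicity.

χ : ∀ {P : Set} → Dec P → ℕ
χ P? = if does P? then 1 else 0

χ-⇔ : ∀ {P Q : Set} → P ⇔ Q → (P? : Dec P) (Q? : Dec Q) → χ P? ≡ χ Q?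
χ-⇔ P⇔Q P? Q? = cong (if_then 1 else 0) (does-⇔ P⇔Q P? Q?)

length-filter≡sum-χ : ∀ {A : Set} {P : A → Set} (P? : Decidable P) xs →
                      length (filter P? xs) ≡ sum (map (χ ∘ P?) xs)
length-filter≡sum-χ P? [] = refl
length-filter≡sum-χ P? (x ∷ xs) with does (P? x)
... | true  = cong suc (length-filter≡sum-χ P? xs)
... | false = length-filter≡sum-χ P? xs

sum-map-+ : ∀ {A : Set} (f g : A → ℕ) xs →
            sum (map (λ x → f x + g x) xs) ≡ sum (map f xs) + sum (map g xs)
sum-map-+ f g [] = refl
sum-map-+ f g (x ∷ xs) = begin
  f x + g x + sum (map (λ x → f x + g x) xs)        ≡⟨ cong (f x + g x +_) (sum-map-+ f g xs) ⟩
  f x + g x + (sum (map f xs) + sum (map g xs))     ≡⟨ interchange (f x) (g x) _ _ ⟩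
  f x + sum (map f xs) + (g x + sum (map g xs))     ∎
  where open ≡-Reasoning

sum-map-0 : ∀ {A : Set} (xs : List A) → sum (map (λ _ → 0) xs) ≡ 0
sum-map-0 [] = refl
sum-map-0 (_ ∷ xs) = sum-map-0 xs

sum-map-comm : ∀ {A B : Set} (f : A → B → ℕ) xs ys →
  sum (map (λ x → sum (map (f x) ys)) xs) ≡ sum (map (λ y → sum (map (λ x → f x y) xs)) ys)
sum-map-comm f [] ys = sym (sum-map-0 ys)
sum-map-comm f (x ∷ xs) ys = begin
  sum (map (f x) ys) + sum (map (λ x → sum (map (f x) ys)) xs)
    ≡⟨ cong (sum (map (f x) ys) +_) (sum-map-comm f xs ys) ⟩
  sum (map (f x) ys) + sum (map (λ y → sum (map (λ x → f x y) xs)) ys)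
    ≡⟨ sum-map-+ (f x) _ ys ⟨
  sum (map (λ y → f x y + sum (map (λ x → f x y) xs)) ys) ∎
  where open ≡-Reasoning

sum-χ-<-upTo : ∀ {μ} B → μ ≤ B → sum (map (λ k → χ (k <? μ)) (upTo B)) ≡ μ
sum-χ-<-upTo {μ} B μ≤B = trans (cong sum (map-upTo _ B)) (go B μ≤B)
  where
  go : ∀ {μ} B → μ ≤ B → sum (applyUpTo (λ k → χ (k <? μ)) B) ≡ μ
  go {zero}  zero    _         = refl
  go {zero}  (suc B) _         = go {zero} B z≤n
  go {suc μ} (suc B) (s≤s μ≤B) = cong suc (go B μ≤B)

unique∧set⇒length≡ : ∀ {A : Set} {xs ys : List A} → Unique xs → Unique ys →
                     xs ∼[ set ] ys → length xs ≡ length ys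
unique∧set⇒length≡ u v xs∼ys = ↭-length (∼bag⇒↭ (unique∧set⇒bag u v xs∼ys))

shifted : (ℕ → ℕ) → ℕ → ℕ → ℕ
shifted f d N = if does (d ≤? N) then f (N ∸ d) else 0

shifted-≤ : ∀ f {d N} → d ≤ N → shifted f d N ≡ f (N ∸ d)
shifted-≤ f {d} {N} d≤N rewrite dec-true (d ≤? N) d≤N = refl

shifted-≰ : ∀ f {d N} → ¬ d ≤ N → shifted f d N ≡ 0
shifted-≰ f {d} {N} d≰N rewrite dec-false (d ≤? N) d≰N = refl

shifted-cong : ∀ {f g} → (∀ M → f M ≡ g M) → ∀ d N → shifted f d N ≡ shifted g d N
shifted-cong f≗g d N = cong (if does (d ≤? N) then_else 0) (f≗g (N ∸ d))

shifted-+ : ∀ f a b N → shifted (shifted f b) a N ≡ shifted f (a + b) N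
shifted-+ f a b N with a ≤? N
... | no a≰N = trans (shifted-≰ (shifted f b) a≰N) (sym (shifted-≰ f (a≰N ∘ m+n≤o⇒m≤o a)))
... | yes a≤N with b ≤? N ∸ a
...   | yes b≤N∸a = begin
  shifted (shifted f b) a N ≡⟨ shifted-≤ (shifted f b) a≤N ⟩
  shifted f b (N ∸ a)       ≡⟨ shifted-≤ f b≤N∸a ⟩
  f (N ∸ a ∸ b)             ≡⟨ cong f (∸-+-assoc N a b) ⟩
  f (N ∸ (a + b))           ≡⟨ shifted-≤ f a+b≤N ⟨
  shifted f (a + b) N       ∎
  where
  open ≡-Reasoning
  a+b≤N : a + b ≤ N
  a+b≤N = subst (_≤ N) (+-comm b a) (m≤o∸n⇒m+n≤o b a≤N b≤N∸a)
...   | no b≰N∸a =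
  trans (shifted-≤ (shifted f b) a≤N) (trans (shifted-≰ f b≰N∸a) (sym (shifted-≰ f a+b≰N)))
  where
  a+b≰N : ¬ a + b ≤ N
  a+b≰N a+b≤N = b≰N∸a (m+n≤o⇒m≤o∸n b (subst (_≤ N) (+-comm a b) a+b≤N))

infix 4 _≽_

_≽_ : Part → Part → Set
(a , _) ≽ (b , y) = b ≤ a × (a ≡ b → y ≡ false)

Ordered : List Part → Set
Ordered = Linked _≽_

ordered⁺ : ∀ {π} → NonIncreasing π → FirstOverlined π → Ordered π
ordered⁺ {[]}              _          _          = []
ordered⁺ {_ ∷ []}          _          _          = [-]
ordered⁺ {_ ∷ _ ∷ _} (b≤a , ni) (fo₁ , fo) = (b≤a , fo₁) ∷ ordered⁺ ni fo

ordered⁻ : ∀ {π} → Ordered π → NonIncreasing π × FirstOverlined π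
ordered⁻ []                = tt , tt
ordered⁻ [-]               = tt , tt
ordered⁻ ((b≤a , fo₁) ∷ o) = let ni , fo = ordered⁻ o in (b≤a , ni) , (fo₁ , fo)

IsOverpartition⇒Ordered : ∀ {N π} → IsOverpartition N π → Ordered π
IsOverpartition⇒Ordered (_ , ni , fo , _) = ordered⁺ ni fo

insert : ℕ → List Part → List Part
insert m []            = (m , false) ∷ []
insert m ((a , x) ∷ π) with m ≤? a
... | yes _ = (a , x) ∷ insert m π
... | no  _ = (m , false) ∷ (a , x) ∷ π

-- Deletes the entry that insert m would have added: the last one whose part is ≥ m.
remove : ℕ → List Part → List Part
remove m []      = []
remove m (p ∷ π) = removeLast≥ p π
  where
  removeLast≥ : Part → List Part → List Part
  removeLast≥ p []            = []
  removeLast≥ p ((c , y) ∷ π) with m ≤? c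
  ... | yes _ = p ∷ removeLast≥ (c , y) π
  ... | no  _ = (c , y) ∷ π

≤?-yes : ∀ {m n} (m≤n : m ≤ n) → (m ≤? n) ≡ yes m≤n
≤?-yes {m} {n} = dec-yes-irr (m ≤? n) ≤-irrelevant

remove-∷-insert : ∀ m p ρ → remove m (p ∷ insert m ρ) ≡ p ∷ ρ
remove-∷-insert m p [] rewrite ≤?-yes (≤-refl {m}) = refl
remove-∷-insert m p ((c , y) ∷ τ) with m ≤? c
... | yes m≤c rewrite ≤?-yes m≤c = cong (p ∷_) (remove-∷-insert m (c , y) τ)
... | no  m≰c rewrite ≤?-yes (≤-refl {m}) | dec-no (m ≤? c) m≰c = refl

remove-insert : ∀ m σ → remove m (insert m σ) ≡ σ
remove-insert m [] = refl
remove-insert m ((a , x) ∷ ρ) with m ≤? a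
... | yes _   = remove-∷-insert m (a , x) ρ
... | no  m≰a rewrite dec-no (m ≤? a) m≰a = refl

insert-injective : ∀ m {σ τ} → insert m σ ≡ insert m τ → σ ≡ τ
insert-injective m {σ} {τ} eq =
  trans (sym (remove-insert m σ)) (trans (cong (remove m) eq) (remove-insert m τ))

≽-insert : ∀ {m} p → m ≤ proj₁ p → p ≽ (m , false)
≽-insert _ m≤a = m≤a , λ _ → refl

insert-≽ : ∀ {m c} y → ¬ m ≤ c → (m , false) ≽ (c , y)
insert-≽ _ m≰c = <⇒≤ (≰⇒> m≰c) , λ { refl → contradiction ≤-refl m≰c }

Ordered-∷-insert : ∀ {m p σ} → m ≤ proj₁ p → Ordered (p ∷ σ) → Ordered (p ∷ insert m σ)
Ordered-∷-insert {m} {p} {[]}          m≤a _ = ≽-insert p m≤a ∷ [-]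
Ordered-∷-insert {m} {p} {(c , y) ∷ ρ} m≤a (p≽c ∷ o) with m ≤? c
... | yes m≤c = p≽c ∷ Ordered-∷-insert m≤c o
... | no  m≰c = ≽-insert p m≤a ∷ insert-≽ y m≰c ∷ o

Ordered-insert : ∀ {m σ} → Ordered σ → Ordered (insert m σ)
Ordered-insert {m} {[]}          _ = [-]
Ordered-insert {m} {(c , y) ∷ ρ} o with m ≤? c
... | yes m≤c = Ordered-∷-insert m≤c o
... | no  m≰c = insert-≽ y m≰c ∷ o

Ordered-∷-insert⁻ : ∀ {m p σ} → Ordered (p ∷ insert m σ) → Ordered (p ∷ σ)
Ordered-∷-insert⁻ {m} {p} {[]}          _ = [-]
Ordered-∷-insert⁻ {m} {p} {(c , y) ∷ ρ} o with m ≤? c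
Ordered-∷-insert⁻ {m} {p} {(c , y) ∷ ρ} (p≽c ∷ o) | yes _ = p≽c ∷ Ordered-∷-insert⁻ o
Ordered-∷-insert⁻ {m} {p} {(c , y) ∷ ρ} ((m≤a , _) ∷ (c≤m , _) ∷ o) | no m≰c =
  (≤-trans c≤m m≤a , λ { refl → contradiction m≤a m≰c }) ∷ o

Ordered-insert⁻ : ∀ {m σ} → Ordered (insert m σ) → Ordered σ
Ordered-insert⁻ {m} {[]}          _ = []
Ordered-insert⁻ {m} {(c , y) ∷ ρ} o with m ≤? c
... | yes _ = Ordered-∷-insert⁻ o
... | no  _ = Linked.tail o

AllPositive-insert : ∀ {m} σ → 1 ≤ m → AllPositive σ → AllPositive (insert m σ)
AllPositive-insert []            m≥1 _ = m≥1 , tt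
AllPositive-insert {m} ((c , _) ∷ ρ) m≥1 (c≥1 , ps) with m ≤? c
... | yes _ = c≥1 , AllPositive-insert ρ m≥1 ps
... | no  _ = m≥1 , c≥1 , ps

AllPositive-insert⁻ : ∀ {m} σ → AllPositive (insert m σ) → AllPositive σ
AllPositive-insert⁻ []            _ = tt
AllPositive-insert⁻ {m} ((c , _) ∷ ρ) ps with m ≤? c
... | yes _ = proj₁ ps , AllPositive-insert⁻ ρ (proj₂ ps)
... | no  _ = proj₂ ps

partSum-insert : ∀ m σ → partSum (insert m σ) ≡ m + partSum σ
partSum-insert m [] = refl
partSum-insert m ((c , _) ∷ ρ) with m ≤? c
... | yes _ = trans (cong (c +_) (partSum-insert m ρ)) (x∙yz≈y∙xz c m (partSum ρ))
... | no  _ = refl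

length-insert : ∀ m σ → length (insert m σ) ≡ suc (length σ)
length-insert m [] = refl
length-insert m ((c , _) ∷ ρ) with m ≤? c
... | yes _ = cong suc (length-insert m ρ)
... | no  _ = refl

countNonOver-∷ : ∀ p ρ j → countNonOver (p ∷ ρ) j ≡ countNonOver [ p ] j + countNonOver ρ j
countNonOver-∷ (a , true)  ρ j = refl
countNonOver-∷ (a , false) ρ j with does (a ≟ j)
... | true  = refl
... | false = refl

countNonOver-∷-self : ∀ m ρ → countNonOver ((m , false) ∷ ρ) m ≡ suc (countNonOver ρ m)
countNonOver-∷-self m ρ =
  cong (if_then suc (countNonOver ρ m) else countNonOver ρ m) (dec-true (m ≟ m) refl)

countNonOver-∷-≢ : ∀ {m j} ρ → m ≢ j → countNonOver ((m , false) ∷ ρ) j ≡ countNonOver ρ j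
countNonOver-∷-≢ {m} {j} ρ m≢j =
  cong (if_then suc (countNonOver ρ j) else countNonOver ρ j) (dec-false (m ≟ j) m≢j)

countNonOver-insert : ∀ m σ j → countNonOver (insert m σ) j ≡ countNonOver ((m , false) ∷ σ) j
countNonOver-insert m [] j = refl
countNonOver-insert m (p@(c , _) ∷ ρ) j with m ≤? c
... | no  _ = refl
... | yes _ = begin
  countNonOver (p ∷ insert m ρ) j                      ≡⟨ countNonOver-∷ p (insert m ρ) j ⟩
  [p] + countNonOver (insert m ρ) j                    ≡⟨ cong ([p] +_) (countNonOver-insert m ρ j) ⟩
  [p] + countNonOver ((m , false) ∷ ρ) j               ≡⟨ cong ([p] +_) (countNonOver-∷ (m , false) ρ j) ⟩
  [p] + ([m] + countNonOver ρ j)                       ≡⟨ x∙yz≈y∙xz [p] [m] _ ⟩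
  [m] + ([p] + countNonOver ρ j)                       ≡⟨ cong ([m] +_) (countNonOver-∷ p ρ j) ⟨
  [m] + countNonOver (p ∷ ρ) j                         ≡⟨ countNonOver-∷ (m , false) (p ∷ ρ) j ⟨
  countNonOver ((m , false) ∷ p ∷ ρ) j                 ∎
  where
  open ≡-Reasoning
  [p] [m] : ℕ
  [p] = countNonOver [ p ] j
  [m] = countNonOver [ (m , false) ] j

countNonOver-insert-self : ∀ m σ → countNonOver (insert m σ) m ≡ suc (countNonOver σ m)
countNonOver-insert-self m σ = trans (countNonOver-insert m σ m) (countNonOver-∷-self m σ)

countNonOver-insert-≢ : ∀ {m j} σ → m ≢ j → countNonOver (insert m σ) j ≡ countNonOver σ j
countNonOver-insert-≢ {m} {j} σ m≢j = trans (countNonOver-insert m σ j) (countNonOver-∷-≢ σ m≢j)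

countNonOver-∷-pos : ∀ {m} p ρ → 0 < countNonOver (p ∷ ρ) m → p ≡ (m , false) ⊎ 0 < countNonOver ρ m
countNonOver-∷-pos         (a , true)  ρ pos = inj₂ pos
countNonOver-∷-pos {m} (a , false) ρ pos with a ≟ m
... | yes refl = inj₁ refl
... | no  a≢m  = inj₂ (subst (0 <_) (countNonOver-∷-≢ ρ a≢m) pos)

head-≥ : ∀ {m q ρ} → Ordered (q ∷ ρ) → 0 < countNonOver (q ∷ ρ) m → m ≤ proj₁ q
head-≥ {q = q} {ρ} o pos with countNonOver-∷-pos q ρ pos
... | inj₁ refl = ≤-refl
head-≥ {ρ = []}    o    pos | inj₂ ()
head-≥ {ρ = _ ∷ _} (q≽q′ ∷ o) pos | inj₂ pos′ = ≤-trans (head-≥ o pos′) (proj₁ q≽q′)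

countNonOver-pos-tail : ∀ {m p q ρ} → Ordered (p ∷ q ∷ ρ) → m ≤ proj₁ q →
                        0 < countNonOver (p ∷ q ∷ ρ) m → 0 < countNonOver (q ∷ ρ) m
countNonOver-pos-tail {m} {p} {q@(c , y)} {ρ} ((c≤m , c≡m⇒y≡false) ∷ _) m≤c pos
  with countNonOver-∷-pos p _ pos
... | inj₂ pos′ = pos′
... | inj₁ refl with ≤-antisym c≤m m≤c
...   | refl rewrite c≡m⇒y≡false refl = subst (0 <_) (sym (countNonOver-∷-self m ρ)) (s≤s z≤n)

insert-remove : ∀ {m π} → Ordered π → 0 < countNonOver π m → insert m (remove m π) ≡ π
insert-remove {m} {p ∷ []} o pos with countNonOver-∷-pos p [] pos
... | inj₁ refl = refl
insert-remove {m} {p ∷ (c , y) ∷ ρ} o@(p≽c ∷ o′) pos with m ≤? c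
... | yes m≤c rewrite ≤?-yes (≤-trans m≤c (proj₁ p≽c)) =
  cong (p ∷_) (insert-remove o′ (countNonOver-pos-tail o m≤c pos))
... | no m≰c with countNonOver-∷-pos p _ pos
...   | inj₁ refl rewrite dec-no (m ≤? c) m≰c = refl
...   | inj₂ pos′ = contradiction (head-≥ o′ pos′) m≰c

IsOverpartition-insert : ∀ {m N σ} → 1 ≤ m → IsOverpartition N σ → IsOverpartition (m + N) (insert m σ)
IsOverpartition-insert {m} {N} {σ} m≥1 (ps , ni , fo , sum≡N) =
  let ni′ , fo′ = ordered⁻ (Ordered-insert (ordered⁺ ni fo)) in
  AllPositive-insert σ m≥1 ps , ni′ , fo′ , trans (partSum-insert m σ) (cong (m +_) sum≡N)

IsOverpartition-insert⁻ : ∀ {m N σ} → IsOverpartition N (insert m σ) → m ≤ N × IsOverpartition (N ∸ m) σ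
IsOverpartition-insert⁻ {m} {N} {σ} (ps , ni , fo , sum≡N) =
  let ni′ , fo′ = ordered⁻ (Ordered-insert⁻ (ordered⁺ ni fo))
      m+sum≡N = trans (sym (partSum-insert m σ)) sum≡N
  in subst (m ≤_) m+sum≡N (m≤m+n m _) ,
     AllPositive-insert⁻ σ ps , ni′ , fo′ , trans (sym (m+n∸m≡n m _)) (cong (_∸ m) m+sum≡N)

Covers : ℕ → ℕ → List Part → Set
Covers r zero    π = ⊤
Covers r (suc k) π = Covers r k π × r ≤ countNonOver π (suc k)

covers? : ∀ r k → Decidable (Covers r k)
covers? r zero    π = yes tt
covers? r (suc k) π = covers? r k π ×-dec r ≤? countNonOver π (suc k)

Covers-insert : ∀ {r k m σ} → k < m → Covers r k (insert m σ) ⇔ Covers r k σ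
Covers-insert {r} {zero}  _   = mk⇔ id id
Covers-insert {r} {suc k} {m} {σ} k<m = mk⇔
  (λ (cov , r≤) → Equivalence.to   ih cov , subst (r ≤_) same r≤)
  (λ (cov , r≤) → Equivalence.from ih cov , subst (r ≤_) (sym same) r≤)
  where
  ih : Covers r k (insert m σ) ⇔ Covers r k σ
  ih = Covers-insert (<⇒≤ k<m)
  same : countNonOver (insert m σ) (suc k) ≡ countNonOver σ (suc k)
  same = countNonOver-insert-≢ σ (λ { refl → <-irrefl refl k<m })

Covers-mono : ∀ {r k l π} → k ≤ l → Covers r l π → Covers r k π
Covers-mono = go ∘ ≤⇒≤′
  where
  go : ∀ {r k l π} → k ≤′ l → Covers r l π → Covers r k π
  go ≤′-refl        cov = cov
  go (≤′-step k≤′l) cov = go k≤′l (proj₁ cov)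

Covers⇒≤length : ∀ {r k π} → 1 ≤ r → Ordered π → Covers r k π → k ≤ length π
Covers⇒≤length {r} {zero}  _   _ _ = z≤n
Covers⇒≤length {r} {suc k} {π} r≥1 o (cov , r≤)
  with remove (suc k) π | insert-remove o (≤-trans r≥1 r≤)
... | σ | refl = subst (suc k ≤_) (sym (length-insert (suc k) σ)) (s≤s k≤|σ|)
  where
  k≤|σ| : k ≤ length σ
  k≤|σ| = Covers⇒≤length r≥1 (Ordered-insert⁻ {σ = σ} o) (Equivalence.to (Covers-insert {σ = σ} ≤-refl) cov)

IsOverpartition-remove : ∀ {m N π} → IsOverpartition N π → 0 < countNonOver π m →
                         m ≤ N × IsOverpartition (N ∸ m) (remove m π)
IsOverpartition-remove {N = N} isop pos = IsOverpartition-insert⁻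
  (subst (IsOverpartition N) (sym (insert-remove (IsOverpartition⇒Ordered isop) pos)) isop)

mexSearch-last : ∀ {r π} t fuel → Covers r t π → ¬ Covers r (t + fuel) π →
  ∃[ m ] mexSearch r π (suc t) fuel ≡ suc m × Covers r m π × ¬ Covers r (suc m) π
mexSearch-last {r} {π} t zero cov ¬cov =
  contradiction (subst (λ k → Covers r k π) (sym (+-identityʳ t)) cov) ¬cov
mexSearch-last {r} {π} t (suc fuel) cov ¬cov with countNonOver π (suc t) <? r
... | yes few =
  t , cong (if_then suc t else mexSearch r π (2 + t) fuel) (dec-true (_ <? r) few) ,
  cov , λ (_ , many) → <⇒≱ few many
... | no ¬few =
  let m , search≡ , cov-m , ¬cov-m = mexSearch-last (suc t) fuel (cov , ≮⇒≥ ¬few)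
                                       (¬cov ∘ subst (λ k → Covers r k π) (sym (+-suc t fuel)))
  in m , trans (cong (if_then suc t else mexSearch r π (2 + t) fuel) (dec-false (_ <? r) ¬few)) search≡ ,
     cov-m , ¬cov-m

mexBar-last : ∀ {r π} → 1 ≤ r → Ordered π →
  ∃[ m ] mexBar r π ≡ suc m × Covers r m π × ¬ Covers r (suc m) π
mexBar-last {π = π} r≥1 o =
  mexSearch-last 0 (suc (length π)) _ (λ cov → <-irrefl refl (Covers⇒≤length r≥1 o cov))

Covers⇔<mexBar : ∀ {r π} → 1 ≤ r → Ordered π → ∀ k → Covers r k π ⇔ k < mexBar r π
Covers⇔<mexBar {r} {π} r≥1 o k with mexBar r π | mexBar-last r≥1 o
... | _ | m , refl , cov , ¬cov = mk⇔
  (λ cov-k → s≤s (≮⇒≥ (λ m<k → ¬cov (Covers-mono m<k cov-k))))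
  (λ { (s≤s k≤m) → Covers-mono k≤m cov })

mexBar≤ : ∀ {r π} → 1 ≤ r → Ordered π → mexBar r π ≤ suc (length π)
mexBar≤ r≥1 o with mexBar-last r≥1 o
... | _ , mex≡ , cov , _ = subst (_≤ _) (sym mex≡) (s≤s (Covers⇒≤length r≥1 o cov))

length≤partSum : ∀ π → AllPositive π → length π ≤ partSum π
length≤partSum []      _          = z≤n
length≤partSum (_ ∷ π) (a≥1 , ps) = +-mono-≤ a≥1 (length≤partSum π ps)

sum-χ-Covers≡mexBar : ∀ {r n π} → 1 ≤ r → IsOverpartition n π →
  sum (map (λ k → χ (covers? r k π)) (upTo (suc n))) ≡ mexBar r π
sum-χ-Covers≡mexBar {r} {n} {π} r≥1 isop@(ps , _ , _ , sum≡n) = begin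
  sum (map (λ k → χ (covers? r k π)) (upTo (suc n)))
    ≡⟨ cong sum (map-cong (λ k → χ-⇔ (Covers⇔<mexBar r≥1 o k) (covers? r k π) (k <? mexBar r π))
                          (upTo (suc n))) ⟩
  sum (map (λ k → χ (k <? mexBar r π)) (upTo (suc n)))
    ≡⟨ sum-χ-<-upTo (suc n) mex≤1+n ⟩
  mexBar r π ∎
  where
  open ≡-Reasoning
  o : Ordered π
  o = IsOverpartition⇒Ordered isop
  mex≤1+n : mexBar r π ≤ suc n
  mex≤1+n = ≤-trans (mexBar≤ r≥1 o) (s≤s (subst (length π ≤_) sum≡n (length≤partSum π ps)))

withCopies : ∀ {P : List Part → Set} → Decidable P → ∀ c m → Decidable (λ π → P π × c ≤ countNonOver π m)
withCopies P? c m π = P? π ×-dec c ≤? countNonOver π m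

module Counting (enum : ℕ → List (List Part)) (enum-ok : ∀ N → Enumerates N (enum N)) where
  open Enumerates

  #[_] : ∀ {P : List Part → Set} → Decidable P → ℕ → ℕ
  #[ P? ] N = length (filter P? (enum N))

  countNonOver-pos⇒≤ : ∀ {m N π} → π ∈ enum N → 0 < countNonOver π m → m ≤ N
  countNonOver-pos⇒≤ π∈ pos = proj₁ (IsOverpartition-remove (sound (enum-ok _) _ π∈) pos)

  more-copies∼insert : ∀ {P} (P? : Decidable P) {m} → 1 ≤ m → (∀ σ → P (insert m σ) ⇔ P σ) →
    ∀ c {N} → m ≤ N →
    filter (withCopies P? (suc c) m) (enum N) ∼[ set ] map (insert m) (filter (withCopies P? c m) (enum (N ∸ m)))
  more-copies∼insert {P} P? {m} m≥1 inv c {N} m≤N = mk⇔ to from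
    where
    to : ∀ {π} → π ∈ filter (withCopies P? (suc c) m) (enum N) →
         π ∈ map (insert m) (filter (withCopies P? c m) (enum (N ∸ m)))
    to {π} mem =
      let π∈ , Pπ , more = ∈-filter⁻ (withCopies P? (suc c) m) mem
          isop = sound (enum-ok N) π π∈
          pos = ≤-trans (s≤s z≤n) more
          σ = remove m π
          π≡ = insert-remove (IsOverpartition⇒Ordered isop) pos
          Pσ = Equivalence.to (inv σ) (subst P (sym π≡) Pπ)
          copies = s≤s⁻¹ (subst (suc c ≤_)
                     (trans (cong (λ ρ → countNonOver ρ m) (sym π≡)) (countNonOver-insert-self m σ)) more)
          σ∈ = complete (enum-ok (N ∸ m)) σ (proj₂ (IsOverpartition-remove isop pos))
      in subst (_∈ _) π≡ (∈-map⁺ (insert m) (∈-filter⁺ (withCopies P? c m) σ∈ (Pσ , copies)))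
    from : ∀ {π} → π ∈ map (insert m) (filter (withCopies P? c m) (enum (N ∸ m))) →
           π ∈ filter (withCopies P? (suc c) m) (enum N)
    from mem with ∈-map⁻ (insert m) mem
    ... | σ , σ∈B , refl =
      let σ∈ , Pσ , copies = ∈-filter⁻ (withCopies P? c m) σ∈B
          isop = subst (λ M → IsOverpartition M (insert m σ)) (m+[n∸m]≡n m≤N)
                   (IsOverpartition-insert m≥1 (sound (enum-ok (N ∸ m)) σ σ∈))
      in ∈-filter⁺ (withCopies P? (suc c) m) (complete (enum-ok N) _ isop)
           (Equivalence.from (inv σ) Pσ , subst (suc c ≤_) (sym (countNonOver-insert-self m σ)) (s≤s copies))

  #-more-copies : ∀ {P} (P? : Decidable P) {m} → 1 ≤ m → (∀ σ → P (insert m σ) ⇔ P σ) → ∀ c N →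
    #[ withCopies P? (suc c) m ] N ≡ shifted #[ withCopies P? c m ] m N
  #-more-copies {P} P? {m} m≥1 inv c N with m ≤? N
  ... | no m≰N = begin
    #[ withCopies P? (suc c) m ] N
      ≡⟨ cong length (filter-none (withCopies P? (suc c) m) (All.tabulate absent)) ⟩
    0
      ≡⟨ shifted-≰ #[ withCopies P? c m ] m≰N ⟨
    shifted #[ withCopies P? c m ] m N ∎
    where
    open ≡-Reasoning
    absent : ∀ {π} → π ∈ enum N → ¬ (P π × suc c ≤ countNonOver π m)
    absent π∈ (_ , more) = m≰N (countNonOver-pos⇒≤ π∈ (≤-trans (s≤s z≤n) more))
  ... | yes m≤N = begin
    #[ withCopies P? (suc c) m ] N
      ≡⟨ unique∧set⇒length≡ (Unique.filter⁺ _ (unique (enum-ok N)))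
           (Unique.map⁺ (insert-injective m) (Unique.filter⁺ _ (unique (enum-ok (N ∸ m)))))
           (more-copies∼insert P? m≥1 inv c m≤N) ⟩
    length (map (insert m) (filter (withCopies P? c m) (enum (N ∸ m))))
      ≡⟨ length-map (insert m) (filter (withCopies P? c m) (enum (N ∸ m))) ⟩
    #[ withCopies P? c m ] (N ∸ m)
      ≡⟨ shifted-≤ #[ withCopies P? c m ] m≤N ⟨
    shifted #[ withCopies P? c m ] m N ∎
    where open ≡-Reasoning

  #-copies : ∀ {P} (P? : Decidable P) {m} → 1 ≤ m → (∀ σ → P (insert m σ) ⇔ P σ) → ∀ c N →
    #[ withCopies P? c m ] N ≡ shifted #[ P? ] (c * m) N
  #-copies P? {m} m≥1 inv zero N =
    trans (cong length (filter-≐ (withCopies P? 0 m) P? (proj₁ , (_, z≤n)) (enum N)))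
          (sym (shifted-≤ #[ P? ] z≤n))
  #-copies P? {m} m≥1 inv (suc c) N = begin
    #[ withCopies P? (suc c) m ] N          ≡⟨ #-more-copies P? m≥1 inv c N ⟩
    shifted #[ withCopies P? c m ] m N      ≡⟨ shifted-cong (#-copies P? m≥1 inv c) m N ⟩
    shifted (shifted #[ P? ] (c * m)) m N   ≡⟨ shifted-+ #[ P? ] m (c * m) N ⟩
    shifted #[ P? ] (suc c * m) N           ∎
    where open ≡-Reasoning

  #-Covers : ∀ r k N → #[ covers? r k ] N ≡ shifted (length ∘ enum) (r * T k) N
  #-Covers r zero N rewrite *-zeroʳ r =
    trans (cong length (filter-all (covers? r 0) (All.universal _ (enum N))))
          (sym (shifted-≤ (length ∘ enum) z≤n))
  #-Covers r (suc k) N = begin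
    #[ covers? r (suc k) ] N
      ≡⟨ #-copies (covers? r k) (s≤s z≤n) (λ _ → Covers-insert ≤-refl) r N ⟩
    shifted #[ covers? r k ] (r * suc k) N
      ≡⟨ shifted-cong (#-Covers r k) (r * suc k) N ⟩
    shifted (shifted (length ∘ enum) (r * T k)) (r * suc k) N
      ≡⟨ shifted-+ (length ∘ enum) (r * suc k) (r * T k) N ⟩
    shifted (length ∘ enum) (r * suc k + r * T k) N
      ≡⟨ cong (λ d → shifted (length ∘ enum) d N) r*T[1+k] ⟨
    shifted (length ∘ enum) (r * T (suc k)) N ∎
    where
    open ≡-Reasoning
    r*T[1+k] : r * T (suc k) ≡ r * suc k + r * T k
    r*T[1+k] = trans (*-distribˡ-+ r (T k) (suc k)) (+-comm (r * T k) (r * suc k))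

proposition3p1 : (enum : ℕ → List (List Part)) → (∀ m → Enumerates m (enum m)) →
    ∀ (n r : ℕ) → 1 ≤ r →
      sum (map (term enum n r) (upTo (suc n))) ≡ sum (map (mexBar r) (enum n))
proposition3p1 enum enum-ok n r r≥1 = begin
  sum (map (term enum n r) (upTo (suc n)))
    -- term enum n r k unfolds to shifted (length ∘ enum) (r * T k) n
    ≡⟨ cong sum (map-cong (λ k → trans (sym (#-Covers r k n)) (length-filter≡sum-χ (covers? r k) (enum n)))
                          ks) ⟩
  sum (map (λ k → sum (map (λ π → χ (covers? r k π)) (enum n))) ks)
    ≡⟨ sum-map-comm (λ k π → χ (covers? r k π)) ks (enum n) ⟩
  sum (map (λ π → sum (map (λ k → χ (covers? r k π)) ks)) (enum n))
    ≡⟨ cong sum (map-cong-local (All.tabulate (sum-χ-Covers≡mexBar r≥1 ∘ Enumerates.sound (enum-ok n) _))) ⟩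
  sum (map (mexBar r) (enum n))   ∎
  where
  open ≡-Reasoning
  open Counting enum enum-ok
  ks : List ℕ
  ks = upTo (suc n)
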